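{- If $G$ is a disjoint union of (one or more) copies of $C_4$, then $\sigma(G)\le 3$.
   Context: A graph $H=(V,E)$ is a sum graph if there is an injective map $\lambda:V\to\mathbb{N}$ such that $E=\{xy : \exists z\in V,\ \lambda(z)=\lambda(x)+\lambda(y)\}$. For a graph $G$ without isolated vertices, $\sigma(G)$ is the minimum $k$ such that $G+N_k$ is a sum graph ($N_k$: $k$ isolated vertices, $+$: disjoint union). $C_4$ is the cycle on four vertices. -}

module Defs where

open import Data.Nat using (ℕ; zero; suc; _<_; _≤_)
open import Data.Fin using (Fin; zero; suc)
open import Data.Product using (Σ; ∃; _×_; _,_)
open import Data.Sum using (_⊎_; inj₁; inj₂)
open import Data.Empty using (⊥)
open import Relation.Nullary using (¬_)
open import Relation.Binary.PropositionalEquality using (_≡_)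
open import Function.Bundles using (_⇔_; _↔_; Inverse)
open import Function.Definitions using (Injective)

record Graph : Set₁ where
  field
    V     : Set
    Adj   : V → V → Set
    sym   : ∀ {x y} → Adj x y → Adj y x
    irr   : ∀ {x} → ¬ Adj x x
open Graph public

IsSumGraph : Graph → Set
IsSumGraph G =
  Σ (V G → ℕ) λ lab →
    Injective _≡_ _≡_ lab ×
    (∀ x → 0 < lab x) ×
    (∀ x y → Adj G x y ⇔ (¬ (x ≡ y) × ∃ λ z → lab z ≡ Data.Nat._+_ (lab x) (lab y)))

AdjN : {V : Set} → (V → V → Set) → (k : ℕ) → V ⊎ Fin k → V ⊎ Fin k → Set
AdjN A k (inj₁ x) (inj₁ y) = A x y
AdjN A k (inj₁ x) (inj₂ _) = ⊥
AdjN A k (inj₂ _) _        = ⊥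

_+N_ : Graph → ℕ → Graph
G +N k = record
  { V   = V G ⊎ Fin k
  ; Adj = AdjN (Adj G) k
  ; sym = λ {x} {y} → s {x} {y}
  ; irr = λ {x} → i {x}
  }
  where
  s : ∀ {x y} → AdjN (Adj G) k x y → AdjN (Adj G) k y x
  s {inj₁ x} {inj₁ y} a = sym G a
  i : ∀ {x} → ¬ AdjN (Adj G) k x x
  i {inj₁ x} a = irr G a

-- σ(G) ≤ b : the minimum k with G + N_k a sum graph is at most b,
-- i.e. some k ≤ b makes G + N_k a sum graph.
σ≤ : Graph → ℕ → Set
σ≤ G b = ∃ λ k → k ≤ b × IsSumGraph (G +N k)

next : Fin 4 → Fin 4
next zero = suc zero
next (suc zero) = suc (suc zero)
next (suc (suc zero)) = suc (suc (suc zero))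
next (suc (suc (suc zero))) = zero

C4Adj : Fin 4 → Fin 4 → Set
C4Adj a b = (b ≡ next a) ⊎ (a ≡ next b)

mC4Adj : (m : ℕ) → Fin m × Fin 4 → Fin m × Fin 4 → Set
mC4Adj m (i , a) (j , b) = (i ≡ j) × C4Adj a b

mC4sym : (m : ℕ) → ∀ {x y} → mC4Adj m x y → mC4Adj m y x
mC4sym m (Relation.Binary.PropositionalEquality.refl , inj₁ e) = Relation.Binary.PropositionalEquality.refl , inj₂ e
mC4sym m (Relation.Binary.PropositionalEquality.refl , inj₂ e) = Relation.Binary.PropositionalEquality.refl , inj₁ e

mC4irr : (m : ℕ) → ∀ {x} → ¬ mC4Adj m x x
mC4irr m {i , zero} (_ , inj₁ ())
mC4irr m {i , zero} (_ , inj₂ ())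
mC4irr m {i , suc zero} (_ , inj₁ ())
mC4irr m {i , suc zero} (_ , inj₂ ())
mC4irr m {i , suc (suc zero)} (_ , inj₁ ())
mC4irr m {i , suc (suc zero)} (_ , inj₂ ())
mC4irr m {i , suc (suc (suc zero))} (_ , inj₁ ())
mC4irr m {i , suc (suc (suc zero))} (_ , inj₂ ())

copiesC4 : ℕ → Graph
copiesC4 m = record
  { V = Fin m × Fin 4 ; Adj = mC4Adj m ; sym = mC4sym m ; irr = mC4irr m }

_≅_ : Graph → Graph → Set
G ≅ H = Σ (V G ↔ V H) λ f →
  ∀ x y → Adj G x y ⇔ Adj H (Inverse.to f x) (Inverse.to f y)

{-# OPTIONS --safe #-}
-- Label each vertex by a base-5 numeral with digits (tag, parity, weight, height).  On the i-th
-- copy of C₄ (vertices 0-1-2-3) vertex a gets weight 1, parity 1 iff a is even, tag ⌊a/2⌋, and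
-- height i if a is even, m − i if a is odd; the three isolated vertices get weight 2, parity 1,
-- height m and tags 0, 1, 2.  No sum of two labels carries, so a sum of labels is a label only if
-- both summands lie on cycles (weights 1 + 1 = 2 force the sum to be an isolated vertex), with
-- opposite parities, which in C₄ = K₂,₂ means adjacent, and with heights i + (m − j) = m, which
-- means i = j.  Conversely the tags along each edge sum to 0, 1 or 2, the tag of an isolated
-- vertex.  Sum labellings transport along graph isomorphisms.
module Submission where

open import Defs
open import Data.Bool using (Bool; true; false; not)
open import Data.Nat using (ℕ; _+_; _*_; _∸_; _≤_; _<_; NonZero; z≤n; s≤s)
open import Data.Nat.Properties
open import Data.Nat.DivMod using (_%_; m<n⇒m%n≡m; [m+kn]%n≡m%n)
open import Data.Nat.Tactic.RingSolver using (solve-∀)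
open import Data.Fin using (Fin; zero; suc; toℕ)
open import Data.Fin.Properties using (toℕ-injective; toℕ<n)
open import Data.Product using (∃; _×_; _,_; proj₁; proj₂)
open import Data.Sum using (_⊎_; inj₁; inj₂)
open import Data.Sum.Function.Propositional using (_⊎-↔_)
open import Function.Bundles using (_⇔_; Inverse; mk⇔; Equivalence)
open import Function.Properties.Inverse using (↔-refl)
open import Relation.Nullary using (¬_)
open import Relation.Binary.PropositionalEquality
  using (_≡_; refl; cong; cong₂; trans; subst; module ≡-Reasoning)
  renaming (sym to ≡-sym)

adjacent⇒distinct : (G : Graph) {x y : V G} → Adj G x y → ¬ x ≡ y
adjacent⇒distinct G xy refl = irr G xy

+N-resp-≅ : ∀ {G H} k → G ≅ H → (G +N k) ≅ (H +N k)
+N-resp-≅ {G} {H} k (f , pres) = (f ⊎-↔ ↔-refl) , adj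
  where
  adj : ∀ x y → Adj (G +N k) x y ⇔
                Adj (H +N k) (Inverse.to (f ⊎-↔ ↔-refl) x) (Inverse.to (f ⊎-↔ ↔-refl) y)
  adj (inj₁ x) (inj₁ y) = pres x y
  adj (inj₁ x) (inj₂ _) = mk⇔ (λ ()) (λ ())
  adj (inj₂ _) y        = mk⇔ (λ ()) (λ ())

IsSumGraph-resp-≅ : ∀ {G H} → G ≅ H → IsSumGraph H → IsSumGraph G
IsSumGraph-resp-≅ {G} {H} (f , pres) (lab , lab-injective , lab-positive , lab-adj) =
  (λ x → lab (to x)) , (λ e → to-injective (lab-injective e)) , (λ x → lab-positive (to x)) ,
  λ x y → mk⇔ (forward x y) (backward x y)
  where
  open Inverse f using (to; from; strictlyInverseˡ; strictlyInverseʳ)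

  to-injective : ∀ {x y} → to x ≡ to y → x ≡ y
  to-injective {x} {y} e = trans (≡-sym (strictlyInverseʳ x)) (trans (cong from e) (strictlyInverseʳ y))

  forward : ∀ x y → Adj G x y → ¬ x ≡ y × ∃ λ z → lab (to z) ≡ lab (to x) + lab (to y)
  forward x y xy with Equivalence.to (lab-adj (to x) (to y)) (Equivalence.to (pres x y) xy)
  ... | distinct , z , e =
    (λ x≡y → distinct (cong to x≡y)) , from z , trans (cong lab (strictlyInverseˡ z)) e

  backward : ∀ x y → ¬ x ≡ y × (∃ λ z → lab (to z) ≡ lab (to x) + lab (to y)) → Adj G x y
  backward x y (distinct , z , e) = Equivalence.from (pres x y)
    (Equivalence.from (lab-adj (to x) (to y)) ((λ e′ → distinct (to-injective e′)) , to z , e))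

σ≤-resp-≅ : ∀ {G H b} → G ≅ H → σ≤ H b → σ≤ G b
σ≤-resp-≅ {G} {H} G≅H (k , k≤b , H+Nk-sum) =
  k , k≤b , IsSumGraph-resp-≅ {G +N k} {H +N k} (+N-resp-≅ {G} {H} k G≅H) H+Nk-sum

digits-injective : ∀ {b r₁ r₂ q₁ q₂} .{{_ : NonZero b}} → r₁ < b → r₂ < b →
                   r₁ + q₁ * b ≡ r₂ + q₂ * b → r₁ ≡ r₂ × q₁ ≡ q₂
digits-injective {b} {r₁} {r₂} {q₁} {q₂} r₁<b r₂<b e =
  r₁≡r₂ , *-cancelʳ-≡ q₁ q₂ b (+-cancelˡ-≡ r₂ _ _ e′)
  where
  open ≡-Reasoning
  r₁≡r₂ : r₁ ≡ r₂
  r₁≡r₂ = begin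
    r₁                ≡⟨ m<n⇒m%n≡m r₁<b ⟨
    r₁ % b            ≡⟨ [m+kn]%n≡m%n r₁ q₁ b ⟨
    (r₁ + q₁ * b) % b ≡⟨ cong (_% b) e ⟩
    (r₂ + q₂ * b) % b ≡⟨ [m+kn]%n≡m%n r₂ q₂ b ⟩
    r₂ % b            ≡⟨ m<n⇒m%n≡m r₂<b ⟩
    r₂                ∎
  e′ : r₂ + q₁ * b ≡ r₂ + q₂ * b
  e′ = subst (λ r → r + q₁ * b ≡ r₂ + q₂ * b) r₁≡r₂ e

-- Base 5 is large enough that adding two numerals whose three low digits are at most 2 never carries.
opaque
  encode : ℕ → ℕ → ℕ → ℕ → ℕ
  encode t p w h = t + (p + (w + h * 5) * 5) * 5

  encode-+ : ∀ t p w h t′ p′ w′ h′ →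
             encode t p w h + encode t′ p′ w′ h′ ≡ encode (t + t′) (p + p′) (w + w′) (h + h′)
  encode-+ = expanded
    where
    expanded : ∀ t p w h t′ p′ w′ h′ →
               (t + (p + (w + h * 5) * 5) * 5) + (t′ + (p′ + (w′ + h′ * 5) * 5) * 5) ≡
               (t + t′) + ((p + p′) + ((w + w′) + (h + h′) * 5) * 5) * 5
    expanded = solve-∀

  encode-injective : ∀ {t p w h t′ p′ w′ h′} → t < 5 → p < 5 → w < 5 → t′ < 5 → p′ < 5 → w′ < 5 →
                     encode t p w h ≡ encode t′ p′ w′ h′ → t ≡ t′ × p ≡ p′ × w ≡ w′ × h ≡ h′
  encode-injective t< p< w< t′< p′< w′< e
    with digits-injective t< t′< e
  ... | t≡t′ , e₁ with digits-injective p< p′< e₁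
  ... | p≡p′ , e₂ with digits-injective w< w′< e₂
  ... | w≡w′ , h≡h′ = t≡t′ , p≡p′ , w≡w′ , h≡h′

  encode-positive : ∀ t p w h → 0 < w → 0 < encode t p w h
  encode-positive t p w h 0<w = <-≤-trans 0<w (begin
    w                                ≤⟨ m≤m+n w (h * 5) ⟩
    w + h * 5                        ≤⟨ m≤m*n (w + h * 5) 5 ⟩
    (w + h * 5) * 5                  ≤⟨ m≤n+m _ p ⟩
    p + (w + h * 5) * 5              ≤⟨ m≤m*n _ 5 ⟩
    (p + (w + h * 5) * 5) * 5        ≤⟨ m≤n+m _ t ⟩
    encode t p w h                   ∎)
    where open ≤-Reasoning

complement-unique : ∀ {m n k} → n ≤ m → k + (m ∸ n) ≡ m → k ≡ n
complement-unique {m} {n} {k} n≤m e = +-cancelʳ-≡ (m ∸ n) k n (trans e (≡-sym (m+[n∸m]≡n n≤m)))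

even : Fin 4 → Bool
even zero                   = true
even (suc zero)             = false
even (suc (suc zero))       = true
even (suc (suc (suc zero))) = false

even-next : ∀ a → even (next a) ≡ not (even a)
even-next zero                   = refl
even-next (suc zero)             = refl
even-next (suc (suc zero))       = refl
even-next (suc (suc (suc zero))) = refl

opposite-parity⇒C4Adj : ∀ a b → even b ≡ not (even a) → C4Adj a b
opposite-parity⇒C4Adj zero                   (suc zero)             _ = inj₁ refl
opposite-parity⇒C4Adj zero                   (suc (suc (suc zero))) _ = inj₂ refl
opposite-parity⇒C4Adj (suc zero)             zero                   _ = inj₂ refl
opposite-parity⇒C4Adj (suc zero)             (suc (suc zero))       _ = inj₁ refl
opposite-parity⇒C4Adj (suc (suc zero))       (suc zero)             _ = inj₂ refl
opposite-parity⇒C4Adj (suc (suc zero))       (suc (suc (suc zero))) _ = inj₁ refl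
opposite-parity⇒C4Adj (suc (suc (suc zero))) zero                   _ = inj₁ refl
opposite-parity⇒C4Adj (suc (suc (suc zero))) (suc (suc zero))       _ = inj₂ refl
opposite-parity⇒C4Adj zero                   zero                   ()
opposite-parity⇒C4Adj zero                   (suc (suc zero))       ()
opposite-parity⇒C4Adj (suc zero)             (suc zero)             ()
opposite-parity⇒C4Adj (suc zero)             (suc (suc (suc zero))) ()
opposite-parity⇒C4Adj (suc (suc zero))       zero                   ()
opposite-parity⇒C4Adj (suc (suc zero))       (suc (suc zero))       ()
opposite-parity⇒C4Adj (suc (suc (suc zero))) (suc zero)             ()
opposite-parity⇒C4Adj (suc (suc (suc zero))) (suc (suc (suc zero))) ()

bit : Bool → Fin 3
bit true  = suc zero
bit false = zero

bit-sum≡1 : ∀ p q → toℕ (bit p) + toℕ (bit q) ≡ 1 → q ≡ not p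
bit-sum≡1 true  false _ = refl
bit-sum≡1 false true  _ = refl
bit-sum≡1 true  true  ()
bit-sum≡1 false false ()

Kind : Set
Kind = Fin 4 ⊎ Fin 3

tag : Kind → Fin 3
tag (inj₁ zero)                   = zero
tag (inj₁ (suc zero))             = zero
tag (inj₁ (suc (suc zero)))       = suc zero
tag (inj₁ (suc (suc (suc zero)))) = suc zero
tag (inj₂ k)                      = k

parity : Kind → Fin 3
parity (inj₁ a) = bit (even a)
parity (inj₂ _) = suc zero

weight : Kind → Fin 3
weight (inj₁ _) = suc zero
weight (inj₂ _) = suc (suc zero)

hub : Fin 4 → Fin 3
hub zero                   = zero
hub (suc zero)             = suc zero
hub (suc (suc zero))       = suc (suc zero)
hub (suc (suc (suc zero))) = suc zero

hub-digits : ∀ a → toℕ (tag (inj₁ a)) + toℕ (tag (inj₁ (next a))) ≡ toℕ (hub a)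
                 × toℕ (parity (inj₁ a)) + toℕ (parity (inj₁ (next a))) ≡ 1
hub-digits zero                   = refl , refl
hub-digits (suc zero)             = refl , refl
hub-digits (suc (suc zero))       = refl , refl
hub-digits (suc (suc (suc zero))) = refl , refl

decode : ℕ → ℕ → ℕ → Kind
decode 0 1 1 = inj₁ zero
decode 0 0 1 = inj₁ (suc zero)
decode 1 1 1 = inj₁ (suc (suc zero))
decode 1 0 1 = inj₁ (suc (suc (suc zero)))
decode 0 _ _ = inj₂ zero
decode 1 _ _ = inj₂ (suc zero)
decode _ _ _ = inj₂ (suc (suc zero))

decode-digits : ∀ k → decode (toℕ (tag k)) (toℕ (parity k)) (toℕ (weight k)) ≡ k
decode-digits (inj₁ zero)                   = refl
decode-digits (inj₁ (suc zero))             = refl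
decode-digits (inj₁ (suc (suc zero)))       = refl
decode-digits (inj₁ (suc (suc (suc zero)))) = refl
decode-digits (inj₂ zero)                   = refl
decode-digits (inj₂ (suc zero))             = refl
decode-digits (inj₂ (suc (suc zero)))       = refl

kind-injective : ∀ {k k′} → toℕ (tag k) ≡ toℕ (tag k′) → toℕ (parity k) ≡ toℕ (parity k′) →
                 toℕ (weight k) ≡ toℕ (weight k′) → k ≡ k′
kind-injective {k} {k′} et ep ew = begin
  k                                                        ≡⟨ decode-digits k ⟨
  decode (toℕ (tag k))  (toℕ (parity k))  (toℕ (weight k))  ≡⟨ cong₂ (λ t p → decode t p _) et ep ⟩
  decode (toℕ (tag k′)) (toℕ (parity k′)) (toℕ (weight k))  ≡⟨ cong (decode _ _) ew ⟩
  decode (toℕ (tag k′)) (toℕ (parity k′)) (toℕ (weight k′)) ≡⟨ decode-digits k′ ⟩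
  k′                                                       ∎
  where open ≡-Reasoning

module Labelling (m : ℕ) where

  Vertex : Set
  Vertex = V (copiesC4 m +N 3)

  kind : Vertex → Kind
  kind (inj₁ (_ , a)) = inj₁ a
  kind (inj₂ k)       = inj₂ k

  level : Bool → Fin m → ℕ
  level true  i = toℕ i
  level false i = m ∸ toℕ i

  level-complement : ∀ p i → level p i + level (not p) i ≡ m
  level-complement true  i = m+[n∸m]≡n (<⇒≤ (toℕ<n i))
  level-complement false i = m∸n+n≡m (<⇒≤ (toℕ<n i))

  level-complement-injective : ∀ p i j → level p i + level (not p) j ≡ m → i ≡ j
  level-complement-injective true  i j e = toℕ-injective (complement-unique (<⇒≤ (toℕ<n j)) e)
  level-complement-injective false i j e =
    toℕ-injective (≡-sym (complement-unique (<⇒≤ (toℕ<n i)) (trans (+-comm (toℕ j) _) e)))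

  level-injective : ∀ p {i j} → level p i ≡ level p j → i ≡ j
  level-injective true  e = toℕ-injective e
  level-injective false {i} {j} e = toℕ-injective (∸-cancelˡ-≡ (<⇒≤ (toℕ<n i)) (<⇒≤ (toℕ<n j)) e)

  height : Vertex → ℕ
  height (inj₁ (i , a)) = level (even a) i
  height (inj₂ _)       = m

  digit : (Kind → Fin 3) → Vertex → ℕ
  digit d x = toℕ (d (kind x))

  digit<5 : ∀ d x → digit d x < 5
  digit<5 d x = ≤-trans (toℕ<n (d (kind x))) (m≤m+n 3 2)

  digit-sum<5 : ∀ d x y → digit d x + digit d y < 5
  digit-sum<5 d x y = s≤s (+-mono-≤ (≤-pred (toℕ<n (d (kind x)))) (≤-pred (toℕ<n (d (kind y)))))

  label : Vertex → ℕ
  label x = encode (digit tag x) (digit parity x) (digit weight x) (height x)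

  vertex-injective : ∀ x y → kind x ≡ kind y → height x ≡ height y → x ≡ y
  vertex-injective (inj₁ (i , a)) (inj₁ (j , .a)) refl e =
    cong (λ i → inj₁ (i , a)) (level-injective (even a) e)
  vertex-injective (inj₂ k)       (inj₂ .k)       refl _ = refl
  vertex-injective (inj₁ _)       (inj₂ _)        ()   _
  vertex-injective (inj₂ _)       (inj₁ _)        ()   _

  label-injective : ∀ {x y} → label x ≡ label y → x ≡ y
  label-injective {x} {y} e
    with encode-injective (digit<5 tag x) (digit<5 parity x) (digit<5 weight x)
                          (digit<5 tag y) (digit<5 parity y) (digit<5 weight y) e
  ... | et , ep , ew , eh = vertex-injective x y (kind-injective et ep ew) eh

  label-positive : ∀ x → 0 < label x
  label-positive x = encode-positive (digit tag x) (digit parity x) _ (height x) (weight-positive (kind x))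
    where
    weight-positive : ∀ k → 0 < toℕ (weight k)
    weight-positive (inj₁ _) = s≤s z≤n
    weight-positive (inj₂ _) = s≤s z≤n

  label-+ : ∀ x y → label x + label y ≡
    encode (digit tag x + digit tag y) (digit parity x + digit parity y)
           (digit weight x + digit weight y) (height x + height y)
  label-+ x y = encode-+ (digit tag x) (digit parity x) (digit weight x) (height x)
                         (digit tag y) (digit parity y) (digit weight y) (height y)

  edge-sum : ∀ i a → label (inj₁ (i , a)) + label (inj₁ (i , next a)) ≡ label (inj₂ (hub a))
  edge-sum i a = begin
    label (inj₁ (i , a)) + label (inj₁ (i , next a))
      ≡⟨ label-+ (inj₁ (i , a)) (inj₁ (i , next a)) ⟩
    encode (toℕ (tag (inj₁ a)) + toℕ (tag (inj₁ (next a))))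
           (toℕ (parity (inj₁ a)) + toℕ (parity (inj₁ (next a)))) 2 heights
      ≡⟨ cong₂ (λ t p → encode t p 2 heights) (proj₁ (hub-digits a)) (proj₂ (hub-digits a)) ⟩
    encode (toℕ (hub a)) 1 2 heights
      ≡⟨ cong (encode (toℕ (hub a)) 1 2) heights≡m ⟩
    label (inj₂ (hub a)) ∎
    where
    open ≡-Reasoning
    heights : ℕ
    heights = level (even a) i + level (even (next a)) i
    heights≡m : heights ≡ m
    heights≡m = trans (cong (λ p → level (even a) i + level p i) (even-next a))
                      (level-complement (even a) i)

  adjacent⇒sum : ∀ x y → Adj (copiesC4 m +N 3) x y → ∃ λ z → label z ≡ label x + label y
  adjacent⇒sum (inj₁ (i , a)) (inj₁ (.i , .(next a))) (refl , inj₁ refl) =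
    inj₂ (hub a) , ≡-sym (edge-sum i a)
  adjacent⇒sum (inj₁ (i , .(next b))) (inj₁ (.i , b)) (refl , inj₂ refl) =
    inj₂ (hub b) , trans (≡-sym (edge-sum i b)) (+-comm (label (inj₁ (i , b))) _)

  sum-digits⇒adjacent : ∀ x y z →
    digit weight z ≡ digit weight x + digit weight y →
    digit parity z ≡ digit parity x + digit parity y →
    height z ≡ height x + height y → Adj (copiesC4 m +N 3) x y
  sum-digits⇒adjacent (inj₁ (i , a)) (inj₁ (j , b)) (inj₂ _) _ ep eh =
    level-complement-injective (even a) i j
      (subst (λ p → level (even a) i + level p j ≡ m) opposite (≡-sym eh)) ,
    opposite-parity⇒C4Adj a b opposite
    where
    opposite : even b ≡ not (even a)
    opposite = bit-sum≡1 (even a) (even b) (≡-sym ep)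
  sum-digits⇒adjacent (inj₁ _) (inj₁ _) (inj₁ _) () _ _
  sum-digits⇒adjacent (inj₁ _) (inj₂ _) (inj₁ _) () _ _
  sum-digits⇒adjacent (inj₁ _) (inj₂ _) (inj₂ _) () _ _
  sum-digits⇒adjacent (inj₂ _) (inj₁ _) (inj₁ _) () _ _
  sum-digits⇒adjacent (inj₂ _) (inj₁ _) (inj₂ _) () _ _
  sum-digits⇒adjacent (inj₂ _) (inj₂ _) (inj₁ _) () _ _
  sum-digits⇒adjacent (inj₂ _) (inj₂ _) (inj₂ _) () _ _

  sum⇒adjacent : ∀ x y z → label z ≡ label x + label y → Adj (copiesC4 m +N 3) x y
  sum⇒adjacent x y z e
    with encode-injective (digit<5 tag z) (digit<5 parity z) (digit<5 weight z)
           (digit-sum<5 tag x y) (digit-sum<5 parity x y) (digit-sum<5 weight x y) (trans e (label-+ x y))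
  ... | _ , ep , ew , eh = sum-digits⇒adjacent x y z ew ep eh

  isSumGraph : IsSumGraph (copiesC4 m +N 3)
  isSumGraph = label , label-injective , label-positive , λ x y →
    mk⇔ (λ xy → adjacent⇒distinct (copiesC4 m +N 3) xy , adjacent⇒sum x y xy)
        (λ { (_ , z , e) → sum⇒adjacent x y z e })

lemma4 : (G : Graph) (m : ℕ) → 1 ≤ m → G ≅ copiesC4 m → σ≤ G 3
lemma4 G m _ G≅mC₄ = σ≤-resp-≅ {G} {copiesC4 m} G≅mC₄ (3 , ≤-refl , Labelling.isSumGraph m)
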